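{- Consider any path-relevant subproblem $(G,P)$, i.e. a directed graph $G$ and a nonempty path $P$ in $G$. Suppose the pivot $x$ of the call $\mathrm{SeqSC1}(G)$ is drawn uniformly at random from $\mathrm{Anc}_G(P)$, let $\alpha=|\mathrm{Anc}_G(P)|$, and let $\alpha'$ denote the number of vertices of $\mathrm{Anc}_G(P)$ that are path active at the next level, i.e. after calling $\mathrm{SeqSC1}(G)$. Then $E[\alpha'\mid x\in\mathrm{Anc}_G(P)]<\alpha/2$.
   Context: Write $u\preceq v$ if there is a (possibly empty) directed path from $u$ to $v$ in the graph under consideration. For a path $P$ in $G$: $\mathrm{Anc}_G(P)$ is the set of vertices that can reach some vertex of $P$ but cannot be reached from any vertex of $P$; $\mathrm{Desc}_G(P)$ is the set of vertices reachable from some vertex of $P$ that cannot reach any vertex of $P$; $\mathrm{Bridge}_G(P)$ is the set of vertices $x$ with $v_i\preceq x\preceq v_j$ for some $v_i,v_j\in P$; a vertex in one of these sets is related to $P$. The call $\mathrm{SeqSC1}(G)$ with pivot $x$ computes $R^+=\{v:x\preceq v\}$, $R^-=\{u:u\preceq x\}$, $V_B=R^+\cap R^-$, $V_S=R^+\setminus V_B$, $V_P=R^-\setminus V_B$, $V_R=V\setminus(V_B\cup V_S\cup V_P)$, adds shortcuts from $x$ to $R^+$ and from $R^-$ to $x$, and recurses on $G[V_S]$, $G[V_P]$, $G[V_R]$. The child path-relevant subproblems of $(G,P)$ are: none if $x$ is a bridge of $P$; $(G[V_R],P)$ if $x$ is unrelated to $P$; if $x$ is an ancestor of $P$, writing $P=P_1\circ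 P_2$ with $P_1$ the vertices of $P$ in $V_R$ and $P_2$ those in $V_S$, the children are $(G[V_R],P_1)$ and $(G[V_S],P_2)$ (each only if the path is nonempty); if $x$ is a descendant, analogously $(G[V_P],P_1)$ and $(G[V_R],P_2)$ with $P_1$ the vertices of $P$ in $V_P$ and $P_2$ those in $V_R$. A vertex is path active at the next level if it belongs to the graph $G'$ of some child subproblem $(G',P')$ and is related (bridge, ancestor, or descendant) to $P'$ within $G'$. -}

module Defs where

open import Data.Nat using (ℕ; zero; suc; _+_)
open import Data.Bool using (Bool; true; false)
open import Data.Fin using (Fin)
open import Data.Vec using (Vec; []; _∷_)
open import Data.Fin.Subset using (Subset; inside; outside)
open import Data.List using (List)
open import Data.List.Membership.Propositional as LM using ()
open import Data.List.Relation.Unary.Linked using (Linked)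
open import Data.List.Relation.Unary.Unique.Propositional using (Unique)
open import Data.Product using (Σ; ∃; _×_; _,_)
open import Data.Sum using (_⊎_)
open import Data.Unit using (⊤)
open import Relation.Nullary using (¬_)
open import Relation.Binary.PropositionalEquality using (_≡_)

Graph : ℕ → Set
Graph n = Fin n → Fin n → Bool

module _ {n : ℕ} (E : Graph n) where

  Edge : Fin n → Fin n → Set
  Edge u v = E u v ≡ true

  IsPath : List (Fin n) → Set
  IsPath P = Unique P × Linked Edge P

  -- Reach S u v : u ⪯ v in the induced subgraph G[S]  (possibly empty path;
  -- all vertices of the walk lie in S).
  data Reach (S : Fin n → Set) : Fin n → Fin n → Set where
    here : ∀ {u} → S u → Reach S u u
    step : ∀ {u w v} → S u → Edge u w → Reach S w v → Reach S u v

  Full : Fin n → Set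
  Full _ = ⊤

  -- Relations to a path, inside the induced subgraph G[S]; the path is
  -- represented by its vertex set Q (only the vertex set matters).
  AncIn : (S Q : Fin n → Set) → Fin n → Set
  AncIn S Q v = S v × (∃ λ p → Q p × Reach S v p) × ¬ (∃ λ p → Q p × Reach S p v)

  DescIn : (S Q : Fin n → Set) → Fin n → Set
  DescIn S Q v = S v × (∃ λ p → Q p × Reach S p v) × ¬ (∃ λ p → Q p × Reach S v p)

  BridgeIn : (S Q : Fin n → Set) → Fin n → Set
  BridgeIn S Q v = S v × (∃ λ p → ∃ λ q → Q p × Q q × Reach S p v × Reach S v q)

  RelatedIn : (S Q : Fin n → Set) → Fin n → Set
  RelatedIn S Q v = BridgeIn S Q v ⊎ AncIn S Q v ⊎ DescIn S Q v

  OnPath : List (Fin n) → Fin n → Set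
  OnPath P v = v LM.∈ P

  Anc Desc Bridge Related : List (Fin n) → Fin n → Set
  Anc P = AncIn Full (OnPath P)
  Desc P = DescIn Full (OnPath P)
  Bridge P = BridgeIn Full (OnPath P)
  Related P = RelatedIn Full (OnPath P)

  -- The partition computed by SeqSC1(G) with pivot x.
  module Pivot (x : Fin n) where
    R⁺ R⁻ VB VS VP VR : Fin n → Set
    R⁺ v = Reach Full x v
    R⁻ u = Reach Full u x
    VB v = R⁺ v × R⁻ v
    VS v = R⁺ v × ¬ R⁻ v
    VP v = R⁻ v × ¬ R⁺ v
    VR v = ¬ R⁺ v × ¬ R⁻ v

  _∩P_ : (Fin n → Set) → List (Fin n) → Fin n → Set
  (S ∩P P) v = OnPath P v × S v

  -- v is path active at the next level (after SeqSC1(G) with pivot x), for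
  -- the path-relevant subproblem (G,P): v lies in the graph of a child
  -- subproblem (G',P') and is related to P' within G'.  A child with empty
  -- path contributes nothing (RelatedIn needs a path vertex).
  PathActive : List (Fin n) → (x v : Fin n) → Set
  PathActive P x v =
      (Anc P x × (RelatedIn VR (VR ∩P P) v ⊎ RelatedIn VS (VS ∩P P) v))
    ⊎ (Desc P x × (RelatedIn VP (VP ∩P P) v ⊎ RelatedIn VR (VR ∩P P) v))
    ⊎ (¬ Related P x × RelatedIn VR (VR ∩P P) v)
    where open Pivot x
  -- (if x is a bridge of P there are no children, hence no active vertex)

sumOver : ∀ {n} → Subset n → (Fin n → ℕ) → ℕ
sumOver [] f = zero
sumOver (inside ∷ A) f = f Fin.zero + sumOver A (λ i → f (Fin.suc i))
sumOver (outside ∷ A) f = sumOver A (λ i → f (Fin.suc i))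

-- If x and v are both ancestors of P and v is path active after pivoting on x,
-- then v ⋠ x, and either x ⪯ v or v reaches a vertex of P that x does not.
-- As the vertices of P are totally ordered by reachability, this relation is
-- asymmetric (in particular irreflexive).  Hence at most α(α − 1)/2 of the
-- ordered pairs of ancestors are active pairs, and averaging over the pivot
-- gives E[α′] ≤ (α − 1)/2 < α/2.
module Submission where

open import Defs
open import Data.Nat using (ℕ; zero; suc; _+_; _*_; _≤_; _<_; z≤n; s≤s)
open import Data.Nat.Properties
  using (≤-refl; ≤-reflexive; +-mono-≤; *-monoʳ-≤; +-monoˡ-≤; m+n≤o⇒n≤o; m<m+n; <-≤-trans; module ≤-Reasoning)
open import Data.Nat.Solver using (module +-*-Solver)
open import Data.Fin using (Fin)
open import Data.Fin.Subset using (Subset; inside; outside; _∈_; _∉_; _⊆_; ∣_∣)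
open import Data.Fin.Subset.Properties using (_∈?_; drop-∷-⊆)
open import Data.Vec as Vec using (_∷_; [])
open import Data.List using (List; []; _∷_)
open import Data.List.Relation.Unary.Any using (here; there)
open import Data.List.Relation.Unary.Linked using (Linked; _∷_)
open import Data.Product using (_×_; _,_; proj₁; ∃)
open import Data.Sum using (_⊎_; inj₁; inj₂)
open import Data.Unit using (tt)
open import Function.Base using (_∘_)
open import Function.Bundles using (_⇔_; Equivalence)
open import Relation.Nullary using (¬_; yes; no; contradiction)
open import Relation.Binary.PropositionalEquality using (_≡_; _≢_; refl; trans; cong; cong₂)

sumOver-cong : ∀ {n} (p : Subset n) {f g : Fin n → ℕ} → (∀ x → f x ≡ g x) → sumOver p f ≡ sumOver p g
sumOver-cong []            f≗g = refl
sumOver-cong (inside ∷ p)  f≗g = cong₂ _+_ (f≗g Fin.zero) (sumOver-cong p (λ x → f≗g (Fin.suc x)))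
sumOver-cong (outside ∷ p) f≗g = sumOver-cong p (λ x → f≗g (Fin.suc x))

sumOver-mono-≤ : ∀ {n} (p : Subset n) {f g : Fin n → ℕ} → (∀ x → f x ≤ g x) → sumOver p f ≤ sumOver p g
sumOver-mono-≤ []            f≤g = z≤n
sumOver-mono-≤ (inside ∷ p)  f≤g = +-mono-≤ (f≤g Fin.zero) (sumOver-mono-≤ p (λ x → f≤g (Fin.suc x)))
sumOver-mono-≤ (outside ∷ p) f≤g = sumOver-mono-≤ p (λ x → f≤g (Fin.suc x))

sumOver-+ : ∀ {n} (p : Subset n) (f g : Fin n → ℕ) → sumOver p (λ x → f x + g x) ≡ sumOver p f + sumOver p g
sumOver-+ []            f g = refl
sumOver-+ (outside ∷ p) f g = sumOver-+ p _ _
sumOver-+ (inside ∷ p)  f g =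
  trans (cong (f Fin.zero + g Fin.zero +_) (sumOver-+ p (λ x → f (Fin.suc x)) (λ x → g (Fin.suc x))))
        (interchange (f Fin.zero) (g Fin.zero) _ _)
  where
  open +-*-Solver
  interchange : ∀ a b c d → (a + b) + (c + d) ≡ (a + c) + (b + d)
  interchange = solve 4 (λ a b c d → (a :+ b) :+ (c :+ d) := (a :+ c) :+ (b :+ d)) refl

sumOver-1 : ∀ {n} (p : Subset n) → sumOver p (λ _ → 1) ≡ ∣ p ∣
sumOver-1 []            = refl
sumOver-1 (inside ∷ p)  = cong suc (sumOver-1 p)
sumOver-1 (outside ∷ p) = sumOver-1 p

indicator : ∀ {n} → Subset n → Fin n → ℕ
indicator (_ ∷ p)       (Fin.suc x) = indicator p x
indicator (inside ∷ p)  Fin.zero    = 1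
indicator (outside ∷ p) Fin.zero    = 0

indicator≤1 : ∀ {n} (p : Subset n) x → indicator p x ≤ 1
indicator≤1 (inside ∷ p)  Fin.zero    = ≤-refl
indicator≤1 (outside ∷ p) Fin.zero    = z≤n
indicator≤1 (_ ∷ p)       (Fin.suc x) = indicator≤1 p x

indicator-∉ : ∀ {n} (p : Subset n) {x} → x ∉ p → indicator p x ≡ 0
indicator-∉ (inside ∷ p)  {Fin.zero}  x∉p = contradiction Vec.here x∉p
indicator-∉ (outside ∷ p) {Fin.zero}  x∉p = refl
indicator-∉ (_ ∷ p)       {Fin.suc x} x∉p = indicator-∉ p (λ x∈p → x∉p (Vec.there x∈p))

indicator-+≤1 : ∀ {n} (p q : Subset n) {x y} → ¬ (x ∈ p × y ∈ q) → indicator p x + indicator q y ≤ 1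
indicator-+≤1 p q {x} {y} ¬both with x ∈? p
... | yes x∈p = +-mono-≤ (indicator≤1 p x) (≤-reflexive (indicator-∉ q (λ y∈q → ¬both (x∈p , y∈q))))
... | no  x∉p = +-mono-≤ (≤-reflexive (indicator-∉ p x∉p)) (indicator≤1 q y)

sumOver-indicator : ∀ {n} (p q : Subset n) → q ⊆ p → sumOver p (indicator q) ≡ ∣ q ∣
sumOver-indicator []            []            q⊆p = refl
sumOver-indicator (inside ∷ p)  (inside ∷ q)  q⊆p = cong suc (sumOver-indicator p q (drop-∷-⊆ q⊆p))
sumOver-indicator (inside ∷ p)  (outside ∷ q) q⊆p = sumOver-indicator p q (drop-∷-⊆ q⊆p)
sumOver-indicator (outside ∷ p) (outside ∷ q) q⊆p = sumOver-indicator p q (drop-∷-⊆ q⊆p)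
sumOver-indicator (outside ∷ p) (inside ∷ q)  q⊆p with q⊆p Vec.here
... | ()

m+m≤1⇒m≡0 : ∀ m → m + m ≤ 1 → m ≡ 0
m+m≤1⇒m≡0 zero    _         = refl
m+m≤1⇒m≡0 (suc m) (s≤s m+1+m≤0) = contradiction (m+n≤o⇒n≤o m m+1+m≤0) λ ()

square-step : ∀ r c d m → r + c ≤ m → 2 * d + m ≤ m * m → 2 * (r + (c + d)) + suc m ≤ suc m * suc m
square-step r c d m r+c≤m 2d+m≤m*m = begin
  2 * (r + (c + d)) + suc m ≡⟨ regroup r c d m ⟩
  2 * (r + c) + (2 * d + m) + 1 ≤⟨ +-monoˡ-≤ 1 (+-mono-≤ (*-monoʳ-≤ 2 r+c≤m) 2d+m≤m*m) ⟩
  2 * m + m * m + 1         ≡⟨ expand m ⟩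
  suc m * suc m             ∎
  where
  open ≤-Reasoning
  open +-*-Solver
  regroup : ∀ r c d m → 2 * (r + (c + d)) + suc m ≡ 2 * (r + c) + (2 * d + m) + 1
  regroup = solve 4 (λ r c d m → con 2 :* (r :+ (c :+ d)) :+ (con 1 :+ m)
                               := con 2 :* (r :+ c) :+ (con 2 :* d :+ m) :+ con 1) refl
  expand : ∀ m → 2 * m + m * m + 1 ≡ suc m * suc m
  expand = solve 1 (λ m → con 2 :* m :+ m :* m :+ con 1 := (con 1 :+ m) :* (con 1 :+ m)) refl

-- The hypothesis makes g an asymmetric, hence irreflexive, 0/1-valued relation,
-- so it holds on at most ∣p∣(∣p∣ − 1)/2 pairs.
2*Σ²+∣p∣≤∣p∣*∣p∣ : ∀ {n} (p : Subset n) (g : Fin n → Fin n → ℕ) → (∀ x y → g x y + g y x ≤ 1)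
                  → 2 * sumOver p (λ x → sumOver p (g x)) + ∣ p ∣ ≤ ∣ p ∣ * ∣ p ∣
2*Σ²+∣p∣≤∣p∣*∣p∣ []            g asym = z≤n
2*Σ²+∣p∣≤∣p∣*∣p∣ (outside ∷ p) g asym =
  2*Σ²+∣p∣≤∣p∣*∣p∣ p (λ x y → g (Fin.suc x) (Fin.suc y)) (λ x y → asym (Fin.suc x) (Fin.suc y))
2*Σ²+∣p∣≤∣p∣*∣p∣ (inside ∷ p)  g asym = begin
  2 * sumOver (inside ∷ p) (λ x → sumOver (inside ∷ p) (g x)) + suc ∣ p ∣
    ≡⟨ cong (λ t → 2 * t + suc ∣ p ∣) split ⟩
  2 * (row + (column + rest)) + suc ∣ p ∣
    ≤⟨ square-step row column rest ∣ p ∣ row+column≤∣p∣ ih ⟩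
  suc ∣ p ∣ * suc ∣ p ∣ ∎
  where
  open ≤-Reasoning
  row column rest : ℕ
  row    = sumOver p (λ y → g Fin.zero (Fin.suc y))
  column = sumOver p (λ x → g (Fin.suc x) Fin.zero)
  rest   = sumOver p (λ x → sumOver p (λ y → g (Fin.suc x) (Fin.suc y)))

  ih : 2 * rest + ∣ p ∣ ≤ ∣ p ∣ * ∣ p ∣
  ih = 2*Σ²+∣p∣≤∣p∣*∣p∣ p (λ x y → g (Fin.suc x) (Fin.suc y)) (λ x y → asym (Fin.suc x) (Fin.suc y))

  split : sumOver (inside ∷ p) (λ x → sumOver (inside ∷ p) (g x)) ≡ row + (column + rest)
  split = cong₂ _+_ (cong (_+ row) (m+m≤1⇒m≡0 _ (asym Fin.zero Fin.zero)))
                    (sumOver-+ p (λ x → g (Fin.suc x) Fin.zero) _)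

  row+column≤∣p∣ : row + column ≤ ∣ p ∣
  row+column≤∣p∣ = begin
    row + column                                               ≡⟨ sumOver-+ p _ _ ⟨
    sumOver p (λ y → g Fin.zero (Fin.suc y) + g (Fin.suc y) Fin.zero) ≤⟨ sumOver-mono-≤ p (asym Fin.zero ∘ Fin.suc) ⟩
    sumOver p (λ _ → 1)                                        ≡⟨ sumOver-1 p ⟩
    ∣ p ∣                                                      ∎

module _ {n : ℕ} {E : Graph n} where

  infix 4 _⪯_
  _⪯_ : Fin n → Fin n → Set
  _⪯_ = Reach E (Full E)

  Reach⇒⪯ : ∀ {S u v} → Reach E S u v → u ⪯ v
  Reach⇒⪯ (here _)        = here tt
  Reach⇒⪯ (step _ e u⇝v) = step tt e (Reach⇒⪯ u⇝v)

  ⪯-trans : ∀ {u v w} → u ⪯ v → v ⪯ w → u ⪯ w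
  ⪯-trans (here _)        v⪯w = v⪯w
  ⪯-trans (step _ e u⪯v) v⪯w = step tt e (⪯-trans u⪯v v⪯w)

  RelatedIn⇒∈ : ∀ {S Q v} → RelatedIn E S Q v → S v
  RelatedIn⇒∈ (inj₁ (v∈S , _))        = v∈S
  RelatedIn⇒∈ (inj₂ (inj₁ (v∈S , _))) = v∈S
  RelatedIn⇒∈ (inj₂ (inj₂ (v∈S , _))) = v∈S

  head⪯ : ∀ {u P q} → Linked (Edge E) (u ∷ P) → OnPath E (u ∷ P) q → u ⪯ q
  head⪯ _         (here refl) = here tt
  head⪯ (e ∷ lnk) (there q∈P) = step tt e (head⪯ lnk q∈P)

  path-⪯-total : ∀ {P p q} → Linked (Edge E) P → OnPath E P p → OnPath E P q → p ⪯ q ⊎ q ⪯ p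
  path-⪯-total lnk       (here refl) q∈P         = inj₁ (head⪯ lnk q∈P)
  path-⪯-total lnk       (there p∈P) (here refl) = inj₂ (head⪯ lnk (there p∈P))
  path-⪯-total (_ ∷ lnk) (there p∈P) (there q∈P) = path-⪯-total lnk p∈P q∈P

  ActiveAncestor : List (Fin n) → Fin n → Fin n → Set
  ActiveAncestor P x v = ¬ v ⪯ x × (x ⪯ v ⊎ ∃ λ p → OnPath E P p × v ⪯ p × ¬ x ⪯ p)

  -- With x an ancestor, the ancestor v can only be active in the child on G[VS],
  -- or in the child on G[VR] as an ancestor of the part of P outside x's reach.
  pathActive⇒activeAncestor : ∀ {P x v} → Anc E P x → Anc E P v → PathActive E P x v → ActiveAncestor P x v
  pathActive⇒activeAncestor _ _ (inj₁ (_ , inj₂ rel)) with RelatedIn⇒∈ rel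
  ... | x⪯v , ¬v⪯x = ¬v⪯x , inj₁ x⪯v
  pathActive⇒activeAncestor _ _ (inj₁ (_ , inj₁ (inj₂ (inj₁ ((_ , ¬v⪯x) , (p , (p∈P , ¬x⪯p , _) , v⇝p) , _))))) =
    ¬v⪯x , inj₂ (p , p∈P , Reach⇒⪯ v⇝p , ¬x⪯p)
  pathActive⇒activeAncestor _ (_ , _ , ¬P⪯v) (inj₁ (_ , inj₁ (inj₁ (_ , p , _ , (p∈P , _) , _ , p⇝v , _)))) =
    contradiction (p , p∈P , Reach⇒⪯ p⇝v) ¬P⪯v
  pathActive⇒activeAncestor _ (_ , _ , ¬P⪯v) (inj₁ (_ , inj₁ (inj₂ (inj₂ (_ , (p , (p∈P , _) , p⇝v) , _))))) =
    contradiction (p , p∈P , Reach⇒⪯ p⇝v) ¬P⪯v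
  pathActive⇒activeAncestor (_ , _ , ¬P⪯x) _ (inj₂ (inj₁ ((_ , P⪯x , _) , _))) = contradiction P⪯x ¬P⪯x
  pathActive⇒activeAncestor x∈Anc _ (inj₂ (inj₂ (unrelated , _))) = contradiction (inj₂ (inj₁ x∈Anc)) unrelated

  activeAncestor-asym : ∀ {P x v} → Linked (Edge E) P → ActiveAncestor P x v → ¬ ActiveAncestor P v x
  activeAncestor-asym _ (_ , inj₁ x⪯v) (¬x⪯v , _) = ¬x⪯v x⪯v
  activeAncestor-asym _ (¬v⪯x , _) (_ , inj₁ v⪯x) = ¬v⪯x v⪯x
  activeAncestor-asym lnk (_ , inj₂ (p , p∈P , v⪯p , ¬x⪯p)) (_ , inj₂ (q , q∈P , x⪯q , ¬v⪯q))
    with path-⪯-total lnk p∈P q∈P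
  ... | inj₁ p⪯q = ¬v⪯q (⪯-trans v⪯p p⪯q)
  ... | inj₂ q⪯p = ¬x⪯p (⪯-trans x⪯q q⪯p)

lemma4 : (n : ℕ) (E : Graph n) (P : List (Fin n)) → IsPath E P → P ≢ []
         → (A : Subset n) → (∀ v → (v ∈ A) ⇔ Anc E P v)
         → (act : Fin n → Subset n)
         → (∀ x v → (v ∈ act x) ⇔ (Anc E P v × PathActive E P x v))
         → 0 < ∣ A ∣
         → 2 * sumOver A (λ x → ∣ act x ∣) < ∣ A ∣ * ∣ A ∣
lemma4 n E P (_ , linked) _ A A⇔Anc act act⇔active 0<∣A∣ = <-≤-trans (m<m+n _ 0<∣A∣) (begin
  2 * sumOver A (λ x → ∣ act x ∣) + ∣ A ∣
    ≡⟨ cong (λ s → 2 * s + ∣ A ∣) (sumOver-cong A λ x → sumOver-indicator A (act x) (act⊆A x)) ⟨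
  2 * sumOver A (λ x → sumOver A (indicator (act x))) + ∣ A ∣
    ≤⟨ 2*Σ²+∣p∣≤∣p∣*∣p∣ A (λ x → indicator (act x)) (λ x v → indicator-+≤1 (act x) (act v) not-both) ⟩
  ∣ A ∣ * ∣ A ∣ ∎)
  where
  open ≤-Reasoning
  act⊆A : ∀ x → act x ⊆ A
  act⊆A x {v} v∈act = Equivalence.from (A⇔Anc v) (proj₁ (Equivalence.to (act⇔active x v) v∈act))

  not-both : ∀ {x v} → ¬ (v ∈ act x × x ∈ act v)
  not-both {x} {v} (v∈act , x∈act)
    with Equivalence.to (act⇔active x v) v∈act | Equivalence.to (act⇔active v x) x∈act
  ... | v∈Anc , v-active | x∈Anc , x-active =
    activeAncestor-asym linked (pathActive⇒activeAncestor x∈Anc v∈Anc v-active)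
                               (pathActive⇒activeAncestor v∈Anc x∈Anc x-active)
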